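{- Suppose that $N$ is an odd number which is either perfect or abundant (i.e. $\sigma(N)\geq 2N$). Let $p_2$ be the second smallest prime divisor of $N$ and let $k$ be the number of distinct prime divisors of $N$. Then $k \geq b_{\frac{4}{3}}(p_2) +1$.
   Context: $\sigma(N)$ is the sum of the positive divisors of $N$. Let $P_j$ denote the $j$-th prime number. For a prime $P_j$ and a real number $\alpha>1$, $b_\alpha(P_j)$ is the smallest positive integer $b$ such that $$\alpha < \prod_{i=0}^{b-1}\frac{P_{j+i}}{P_{j+i}-1}.$$ -}

module Defs where

open import Data.Nat using (ℕ; zero; suc; _+_; _*_; _∸_; _<_; _≤_)
open import Data.Nat.Divisibility using (_∣_; _∣?_)
open import Data.Nat.Primality using (Prime; prime?)
open import Data.List using (List; filter; upTo; length)
open import Data.Nat.ListAction using (sum)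
open import Data.Vec using (Vec; lookup; foldr)
open import Data.Fin using (Fin; toℕ)
open import Data.Product using (Σ; _×_)
open import Relation.Nullary using (¬_)
open import Relation.Nullary.Decidable using (_×-dec_)
open import Relation.Binary.PropositionalEquality using (_≡_)

-- σ(N): sum of the positive divisors of N (for N ≥ 1 every divisor is ≤ N).
σ : ℕ → ℕ
σ N = sum (filter (_∣? N) (upTo (suc N)))

ω : ℕ → ℕ
ω N = length (filter (λ p → prime? p ×-dec p ∣? N) (upTo (suc N)))

primesBelow : ℕ → ℕ
primesBelow n = length (filter prime? (upTo n))

-- IsNthPrime j p : p is the j-th prime P_j, indexed so that P_1 = 2
-- (exactly j - 1 primes lie below p).
IsNthPrime : ℕ → ℕ → Set
IsNthPrime j p = Prime p × suc (primesBelow p) ≡ j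

IsSecondSmallestPrimeDivisor : ℕ → ℕ → Set
IsSecondSmallestPrimeDivisor N p₂ =
  Prime p₂ × p₂ ∣ N ×
  Σ ℕ (λ p₁ → Prime p₁ × p₁ ∣ N × p₁ < p₂ ×
               (∀ q → Prime q → q ∣ N → q < p₂ → q ≡ p₁))

vprod : ∀ {n} → Vec ℕ n → ℕ
vprod = foldr _ _*_ 1

vprodPred : ∀ {n} → Vec ℕ n → ℕ
vprodPred = foldr _ (λ x r → (x ∸ 1) * r) 1

-- For α = a / c (a, c ≥ 1), and the prime p = P_j:
-- Exceeds a c p b  :⇔  a/c < ∏_{i=0}^{b-1} P_{j+i}/(P_{j+i}-1),
-- written with denominators cleared:  a * ∏ (P_{j+i} - 1) < c * ∏ P_{j+i}.
-- (P_{j+i} - 1 ≥ 1, so this is equivalent to the rational inequality.)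
Exceeds : ℕ → ℕ → ℕ → ℕ → Set
Exceeds a c p b =
  Σ ℕ λ j → IsNthPrime j p ×
  Σ (Vec ℕ b) λ ps → (∀ (i : Fin b) → IsNthPrime (j + toℕ i) (lookup ps i)) ×
    a * vprodPred ps < c * vprod ps

IsB : ℕ → ℕ → ℕ → ℕ → Set
IsB a c p b = 1 ≤ b × Exceeds a c p b × (∀ b′ → 1 ≤ b′ → b′ < b → ¬ Exceeds a c p b′)

{-# OPTIONS --safe #-}
-- σ(N)/N < ∏_{q ∣ N} q/(q-1). For odd N the smallest prime divisor q₁ is at least 3 and
-- contributes a factor at most 3/2, so σ(N) ≥ 2N leaves a product exceeding 4/3 over the
-- other k - 1 prime divisors. These are distinct primes ≥ p₂ and x/(x-1) decreases, so the
-- product over the k - 1 consecutive primes from p₂ on exceeds 4/3 as well: b_{4/3}(p₂) ≤ k - 1.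
module Submission where

open import Defs
open import Data.Nat
open import Data.Nat.Properties
open import Data.Nat.Divisibility
open import Data.Nat.Primality
open import Data.Nat.Primality.Factorisation using (factorise)
open import Data.Nat.Coprimality using (Coprime; coprime-divisor)
open import Data.Nat.Induction using (<-rec)
open import Data.Nat.ListAction using (sum; product)
open import Data.Nat.ListAction.Properties using (sum-++; product≢0)
import Data.List.Relation.Unary.All.Properties as All
open import Data.List using (List; []; _∷_; _++_; [_]; filter; upTo; map; length)
open import Data.List.Properties using (upTo-∷ʳ; filter-++; length-++)
open import Data.List.Membership.Propositional using (_∈_)
open import Data.List.Relation.Binary.Subset.Propositional using (_⊆_)
open import Data.List.Membership.Propositional.Properties
  using (∈-filter⁺; ∈-filter⁻; ∈-upTo⁺; ∈-∃++; ∈-++⁺ˡ; ∈-++⁺ʳ; ∈-++⁻; ∈-map⁺)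
open import Data.List.Relation.Unary.Any using (here; there)
open import Data.List.Relation.Unary.All as All using (All; []; _∷_)
open import Data.List.Relation.Unary.AllPairs using (AllPairs; []; _∷_)
import Data.List.Relation.Unary.AllPairs.Properties as AllPairs
open import Data.List.Relation.Unary.Unique.Propositional using (Unique)
import Data.List.Relation.Unary.Unique.Propositional.Properties as Unique
open import Data.Vec using (Vec; []; _∷_; lookup)
open import Data.Fin using (toℕ; zero; suc)
open import Data.Product using (Σ; ∃; ∃₂; _×_; _,_; proj₁; proj₂; map₂)
open import Data.Sum using (inj₁; inj₂)
open import Data.Empty using (⊥-elim)
open import Function using (id)
open import Relation.Nullary using (¬_; Dec; yes; no)
open import Relation.Nullary.Decidable using (_×-dec_)
open import Relation.Binary.PropositionalEquality hiding ([_])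
open import Data.Nat.Solver using (module +-*-Solver)
open +-*-Solver

divisors : ℕ → List ℕ
divisors N = filter (_∣? N) (upTo (suc N))

∈-divisors⁺ : ∀ {d N} → .{{NonZero N}} → d ∣ N → d ∈ divisors N
∈-divisors⁺ {d} {N} d∣N = ∈-filter⁺ (_∣? N) (∈-upTo⁺ (s≤s (∣⇒≤ d∣N))) d∣N

∈-divisors⁻ : ∀ {d N} → d ∈ divisors N → d ∣ N
∈-divisors⁻ {d} {N} d∈ = proj₂ (∈-filter⁻ (_∣? N) {xs = upTo (suc N)} d∈)

divisors-unique : ∀ N → Unique (divisors N)
divisors-unique N = Unique.filter⁺ (_∣? N) (Unique.upTo⁺ (suc N))

sum-mono-⊆ : ∀ {xs ys : List ℕ} → Unique xs → xs ⊆ ys → sum xs ≤ sum ys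
sum-mono-⊆ {[]} _ _ = z≤n
sum-mono-⊆ {x ∷ xs} {ys} (x∉xs ∷ xs!) xs⊆ys with ∈-∃++ (xs⊆ys (here refl))
... | us , vs , refl = begin
  x + sum xs            ≤⟨ +-monoʳ-≤ x (sum-mono-⊆ xs! xs⊆us++vs) ⟩
  x + sum (us ++ vs)    ≡⟨ cong (x +_) (sum-++ us vs) ⟩
  x + (sum us + sum vs) ≡⟨ solve 3 (λ a b c → a :+ (b :+ c) := b :+ (a :+ c)) refl x (sum us) (sum vs) ⟩
  sum us + (x + sum vs) ≡⟨ sum-++ us (x ∷ vs) ⟨
  sum (us ++ x ∷ vs)    ∎
  where
  open ≤-Reasoning
  xs⊆us++vs : xs ⊆ us ++ vs
  xs⊆us++vs {z} z∈xs with ∈-++⁻ us (xs⊆ys (there z∈xs))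
  ... | inj₁ z∈us         = ∈-++⁺ˡ z∈us
  ... | inj₂ (here z≡x)   = ⊥-elim (All.lookup x∉xs z∈xs (sym z≡x))
  ... | inj₂ (there z∈vs) = ∈-++⁺ʳ us z∈vs

sum-map-*ˡ : ∀ q xs → sum (map (q *_) xs) ≡ q * sum xs
sum-map-*ˡ q []       = sym (*-zeroʳ q)
sum-map-*ˡ q (x ∷ xs) = trans (cong (q * x +_) (sum-map-*ˡ q xs)) (sym (*-distribˡ-+ q x (sum xs)))

σ≥1 : ∀ m → .{{NonZero m}} → 1 ≤ σ m
σ≥1 m = sum-mono-⊆ {xs = [ 1 ]} ([] ∷ []) (λ { (here refl) → ∈-divisors⁺ (1∣ m) })

prime∤⇒coprime : ∀ {q d} → Prime q → ¬ q ∣ d → Coprime d q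
prime∤⇒coprime pq q∤d (c∣d , c∣q) with prime⇒irreducible pq c∣q
... | inj₁ c≡1 = c≡1
... | inj₂ refl = ⊥-elim (q∤d c∣d)

coprime-divisor-^ : ∀ {d q m} a → Coprime d q → d ∣ q ^ a * m → d ∣ m
coprime-divisor-^ {d} {q} {m} zero    d⊥q d∣m = subst (d ∣_) (*-identityˡ m) d∣m
coprime-divisor-^ {d} {q} {m} (suc a) d⊥q d∣qqᵃm =
  coprime-divisor-^ a d⊥q (coprime-divisor d⊥q (subst (d ∣_) (*-assoc q (q ^ a) m) d∣qqᵃm))

-- A divisor of q·qᵃm is either q times a divisor of qᵃm, or prime to q and hence a divisor of m.
σ[q*qᵃm]≤σ[m]+q*σ[qᵃm] : ∀ {q} → Prime q → ∀ a m → .{{NonZero m}} →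
  σ (q * (q ^ a * m)) ≤ σ m + q * σ (q ^ a * m)
σ[q*qᵃm]≤σ[m]+q*σ[qᵃm] {q} pq a m = begin
  σ (q * X)                                   ≤⟨ sum-mono-⊆ (divisors-unique (q * X)) split ⟩
  sum (divisors m ++ map (q *_) (divisors X)) ≡⟨ sum-++ (divisors m) _ ⟩
  σ m + sum (map (q *_) (divisors X))         ≡⟨ cong (σ m +_) (sum-map-*ˡ q (divisors X)) ⟩
  σ m + q * σ X                               ∎
  where
  open ≤-Reasoning
  X = q ^ a * m
  instance
    _ : NonZero q
    _ = prime⇒nonZero pq
    _ : NonZero X
    _ = m*n≢0 (q ^ a) m {{m^n≢0 q a}}
    _ : NonZero (q * X)
    _ = m*n≢0 q X
  split : divisors (q * X) ⊆ divisors m ++ map (q *_) (divisors X)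
  split {d} d∈ with q ∣? d
  ... | yes (divides e refl) =
    ∈-++⁺ʳ (divisors m) (subst (_∈ map (q *_) (divisors X)) (*-comm q e)
      (∈-map⁺ (q *_) (∈-divisors⁺ (*-cancelˡ-∣ q (subst (_∣ q * X) (*-comm e q) (∈-divisors⁻ d∈))))))
  ... | no q∤d = ∈-++⁺ˡ (∈-divisors⁺ (coprime-divisor-^ a d⊥q (coprime-divisor d⊥q (∈-divisors⁻ d∈))))
    where d⊥q = prime∤⇒coprime pq q∤d

-- The slack σ(m) is kept explicit so that the induction on a goes through.
σ[qᵃm]*[q∸1]+σ[m]≤q^[1+a]*σ[m] : ∀ {q} → Prime q → ∀ a m → .{{NonZero m}} →
  σ (q ^ a * m) * (q ∸ 1) + σ m ≤ q ^ suc a * σ m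
σ[qᵃm]*[q∸1]+σ[m]≤q^[1+a]*σ[m] {suc r} pq zero m = ≤-reflexive (begin
  σ (1 * m) * r + σ m ≡⟨ cong (λ z → σ z * r + σ m) (*-identityˡ m) ⟩
  σ m * r + σ m       ≡⟨ solve 2 (λ s r → s :* r :+ s := ((con 1 :+ r) :* con 1) :* s) refl (σ m) r ⟩
  (suc r * 1) * σ m   ∎)
  where open ≡-Reasoning
σ[qᵃm]*[q∸1]+σ[m]≤q^[1+a]*σ[m] {q@(suc r)} pq (suc a) m = begin
  σ (q ^ suc a * m) * r + σ m   ≡⟨ cong (λ z → σ z * r + σ m) (*-assoc q (q ^ a) m) ⟩
  σ (q * X) * r + σ m           ≤⟨ +-monoˡ-≤ (σ m) (*-monoˡ-≤ r (σ[q*qᵃm]≤σ[m]+q*σ[qᵃm] pq a m)) ⟩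
  (σ m + q * σ X) * r + σ m     ≡⟨ solve 3 (λ s x r → (s :+ (con 1 :+ r) :* x) :* r :+ s := (con 1 :+ r) :* (x :* r :+ s))
                                      refl (σ m) (σ X) r ⟩
  q * (σ X * r + σ m)           ≤⟨ *-monoʳ-≤ q (σ[qᵃm]*[q∸1]+σ[m]≤q^[1+a]*σ[m] pq a m) ⟩
  q * (q ^ suc a * σ m)         ≡⟨ *-assoc q (q ^ suc a) (σ m) ⟨
  q ^ suc (suc a) * σ m         ∎
  where
  open ≤-Reasoning
  X = q ^ a * m

prime-divisor : ∀ n → 1 < n → ∃ λ p → Prime p × p ∣ n
prime-divisor n 1<n with factorise n {{>-nonZero (<-trans z<s 1<n)}}
... | record { factors = [] ; isFactorisation = refl } = ⊥-elim (<-irrefl refl 1<n)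
... | record { factors = p ∷ ps ; isFactorisation = n≡p*∏ps ; factorsPrime = pp ∷ _ } =
  p , pp , subst (p ∣_) (sym n≡p*∏ps) (m∣m*n (product ps))

prime-power-split : ∀ {q} → Prime q → ∀ m → .{{NonZero m}} →
  ∃₂ λ a m′ → m ≡ q ^ a * m′ × ¬ q ∣ m′
prime-power-split {q} pq = <-rec Split split
  where
  instance
    _ : NonTrivial q
    _ = prime⇒nonTrivial pq
  Split : ℕ → Set
  Split m = .{{NonZero m}} → ∃₂ λ a m′ → m ≡ q ^ a * m′ × ¬ q ∣ m′
  split : ∀ m → (∀ {k} → k < m → Split k) → Split m
  split m rec with q ∣? m
  ... | no q∤m = 0 , m , sym (*-identityˡ m) , q∤m
  ... | yes q∣m with rec (quotient-< q∣m) {{quotient≢0 q∣m}}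
  ...   | a , m′ , k≡qᵃm′ , q∤m′ = suc a , m′ , m≡qᵃ⁺¹m′ , q∤m′
    where
    m≡qᵃ⁺¹m′ : m ≡ q ^ suc a * m′
    m≡qᵃ⁺¹m′ = begin
      m                   ≡⟨ m∣n⇒n≡quotient*m q∣m ⟩
      quotient q∣m * q    ≡⟨ cong (_* q) k≡qᵃm′ ⟩
      (q ^ a * m′) * q    ≡⟨ solve 3 (λ qᵃ m′ q → (qᵃ :* m′) :* q := (q :* qᵃ) :* m′) refl (q ^ a) m′ q ⟩
      q ^ suc a * m′      ∎
      where open ≡-Reasoning

∏[p∸1]≢0 : ∀ {S} → All Prime S → NonZero (product (map (_∸ 1) S))
∏[p∸1]≢0 ps = product≢0 (All.map⁺ (All.map p∸1≢0 ps))
  where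
  p∸1≢0 : ∀ {p} → Prime p → NonZero (p ∸ 1)
  p∸1≢0 {suc (suc _)} _ = _

mutual
  abundancy-≤ : ∀ S m → All Prime S → .{{NonZero m}} → (∀ r → Prime r → r ∣ m → r ∈ S) →
    σ m * product (map (_∸ 1) S) ≤ m * product S
  abundancy-≤ [] 1 _ _ = ≤-refl
  abundancy-≤ [] m@(suc (suc _)) _ covers with prime-divisor m (s<s z<s)
  ... | p , pp , p∣m with covers p pp p∣m
  ... | ()
  abundancy-≤ (q ∷ S) m ps covers = <⇒≤ (abundancy-< q S m ps covers)

  abundancy-< : ∀ q S m → All Prime (q ∷ S) → .{{NonZero m}} → (∀ r → Prime r → r ∣ m → r ∈ q ∷ S) →
    σ m * product (map (_∸ 1) (q ∷ S)) < m * product (q ∷ S)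
  abundancy-< q S m (pq ∷ ps) covers with prime-power-split pq m
  ... | a , m′ , refl , q∤m′ = begin-strict
    σ X * ((q ∸ 1) * P)                ≡⟨ *-assoc (σ X) (q ∸ 1) P ⟨
    (σ X * (q ∸ 1)) * P                <⟨ *-monoˡ-< P {{∏[p∸1]≢0 ps}} (m<m+n (σ X * (q ∸ 1)) (σ≥1 m′)) ⟩
    (σ X * (q ∸ 1) + σ m′) * P         ≤⟨ *-monoˡ-≤ P (σ[qᵃm]*[q∸1]+σ[m]≤q^[1+a]*σ[m] pq a m′) ⟩
    (q ^ suc a * σ m′) * P             ≡⟨ *-assoc (q ^ suc a) (σ m′) P ⟩
    q ^ suc a * (σ m′ * P)             ≤⟨ *-monoʳ-≤ (q ^ suc a) (abundancy-≤ S m′ ps covers′) ⟩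
    q ^ suc a * (m′ * product S)       ≡⟨ solve 4 (λ q qᵃ m Q → (q :* qᵃ) :* (m :* Q) := (qᵃ :* m) :* (q :* Q))
                                            refl q (q ^ a) m′ (product S) ⟩
    X * (q * product S)                ∎
    where
    open ≤-Reasoning
    X = q ^ a * m′
    P = product (map (_∸ 1) S)
    instance
      _ : NonZero m′
      _ = m*n≢0⇒n≢0 (q ^ a)
    covers′ : ∀ r → Prime r → r ∣ m′ → r ∈ S
    covers′ r pr r∣m′ with covers r pr (∣-trans r∣m′ (n∣m*n (q ^ a)))
    ... | here refl = ⊥-elim (q∤m′ r∣m′)
    ... | there r∈S = r∈S

primesBelow-suc : ∀ x → primesBelow (suc x) ≡ primesBelow x + length (filter prime? [ x ])
primesBelow-suc x = begin
  length (filter prime? (upTo (suc x)))                   ≡⟨ cong (λ xs → length (filter prime? xs)) (upTo-∷ʳ x) ⟨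
  length (filter prime? (upTo x ++ [ x ]))                ≡⟨ cong length (filter-++ prime? (upTo x) [ x ]) ⟩
  length (filter prime? (upTo x) ++ filter prime? [ x ])  ≡⟨ length-++ (filter prime? (upTo x)) ⟩
  primesBelow x + length (filter prime? [ x ])            ∎
  where open ≡-Reasoning

primesBelow-suc-prime : ∀ {x} → Prime x → primesBelow (suc x) ≡ suc (primesBelow x)
primesBelow-suc-prime {x} px with prime? x | primesBelow-suc x
... | yes _ | eq = trans eq (+-comm (primesBelow x) 1)
... | no ¬px | _ = ⊥-elim (¬px px)

primesBelow-suc-¬prime : ∀ {x} → ¬ Prime x → primesBelow (suc x) ≡ primesBelow x
primesBelow-suc-¬prime {x} ¬px with prime? x | primesBelow-suc x
... | yes px | _ = ⊥-elim (¬px px)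
... | no _ | eq = trans eq (+-identityʳ (primesBelow x))

primesBelow-mono-≤ : ∀ {x y} → x ≤ y → primesBelow x ≤ primesBelow y
primesBelow-mono-≤ x≤y = mono (≤⇒≤′ x≤y)
  where
  mono : ∀ {x y} → x ≤′ y → primesBelow x ≤ primesBelow y
  mono ≤′-refl = ≤-refl
  mono (≤′-step {y} x≤′y) =
    ≤-trans (mono x≤′y) (subst (primesBelow y ≤_) (sym (primesBelow-suc y)) (m≤m+n _ _))

primesBelow-mono-< : ∀ {x y} → Prime x → x < y → suc (primesBelow x) ≤ primesBelow y
primesBelow-mono-< px x<y = subst (_≤ _) (primesBelow-suc-prime px) (primesBelow-mono-≤ x<y)

nthPrime-below : ∀ x n → 1 ≤ n → n ≤ primesBelow x → ∃ λ p → IsNthPrime n p × p < x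
nthPrime-below zero n 1≤n n≤0 = ⊥-elim (<⇒≱ 1≤n n≤0)
nthPrime-below (suc x) n 1≤n n≤π with prime? x
... | no ¬px = map₂ (map₂ m<n⇒m<1+n) (nthPrime-below x n 1≤n (subst (n ≤_) (primesBelow-suc-¬prime ¬px) n≤π))
... | yes px with m≤n⇒m<n∨m≡n (subst (n ≤_) (primesBelow-suc-prime px) n≤π)
...   | inj₂ refl = x , (px , refl) , ≤-refl
...   | inj₁ n<1+π = map₂ (map₂ m<n⇒m<1+n) (nthPrime-below x n 1≤n (≤-pred n<1+π))

ConsecutivePrimesFrom : ℕ → ∀ {b} → Vec ℕ b → Set
ConsecutivePrimesFrom j ps = ∀ i → IsNthPrime (j + toℕ i) (lookup ps i)

m≤n⇒[m∸1]*n≤[n∸1]*m : ∀ {m n} → m ≤ n → (m ∸ 1) * n ≤ (n ∸ 1) * m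
m≤n⇒[m∸1]*n≤[n∸1]*m {zero} _ = z≤n
m≤n⇒[m∸1]*n≤[n∸1]*m {suc m} {suc n} (s≤s m≤n) = begin
  m * suc n ≡⟨ *-suc m n ⟩
  m + m * n ≤⟨ +-monoˡ-≤ (m * n) m≤n ⟩
  n + m * n ≡⟨ cong (n +_) (*-comm m n) ⟩
  n + n * m ≡⟨ *-suc n m ⟨
  n * suc m ∎
  where open ≤-Reasoning

-- The i-th prime from P_j on is at most the i-th element of T, and x/(x-1) decreases in x.
consecutivePrimes-ratio-≥ : ∀ T j → AllPairs _<_ T → All Prime T → 1 ≤ j →
  All (λ t → j ≤ suc (primesBelow t)) T →
  Σ (Vec ℕ (length T)) λ ps → ConsecutivePrimesFrom j ps ×
    vprodPred ps * product T ≤ product (map (_∸ 1) T) * vprod ps × 1 ≤ vprod ps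
consecutivePrimes-ratio-≥ [] j _ _ _ _ = [] , (λ ()) , ≤-refl , ≤-refl
consecutivePrimes-ratio-≥ (t ∷ T) j (t<T ∷ sorted) (pt ∷ pT) 1≤j (j≤πt ∷ _)
  with nthPrime-below (suc t) j 1≤j (subst (j ≤_) (sym (primesBelow-suc-prime pt)) j≤πt)
... | p , nthP , p<1+t
  with consecutivePrimes-ratio-≥ T (suc j) sorted pT (s≤s z≤n)
         (All.map (λ t<t′ → s≤s (≤-trans j≤πt (primesBelow-mono-< pt t<t′))) t<T)
... | ps , consecutive , ratio , ∏ps≥1 =
  p ∷ ps , consecutive′ , ratio′ , *-mono-≤ (>-nonZero⁻¹ p {{prime⇒nonZero (proj₁ nthP)}}) ∏ps≥1
  where
  consecutive′ : ConsecutivePrimesFrom j (p ∷ ps)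
  consecutive′ zero    = subst (λ n → IsNthPrime n p) (sym (+-identityʳ j)) nthP
  consecutive′ (suc i) = subst (λ n → IsNthPrime n (lookup ps i)) (sym (+-suc j (toℕ i))) (consecutive i)
  P′ = vprodPred ps
  Q′ = vprod ps
  P = product (map (_∸ 1) T)
  Q = product T
  ratio′ : ((p ∸ 1) * P′) * (t * Q) ≤ ((t ∸ 1) * P) * (p * Q′)
  ratio′ = begin
    ((p ∸ 1) * P′) * (t * Q) ≡⟨ solve 4 (λ a b c d → (a :* b) :* (c :* d) := (a :* c) :* (b :* d)) refl (p ∸ 1) P′ t Q ⟩
    ((p ∸ 1) * t) * (P′ * Q) ≤⟨ *-mono-≤ (m≤n⇒[m∸1]*n≤[n∸1]*m (≤-pred p<1+t)) ratio ⟩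
    ((t ∸ 1) * p) * (P * Q′) ≡⟨ solve 4 (λ a b c d → (a :* b) :* (c :* d) := (a :* c) :* (b :* d)) refl (t ∸ 1) p P Q′ ⟩
    ((t ∸ 1) * P) * (p * Q′) ∎
    where open ≤-Reasoning

3≤q⇒2*q≤3*[q∸1] : ∀ {q} → 3 ≤ q → 2 * q ≤ 3 * (q ∸ 1)
3≤q⇒2*q≤3*[q∸1] {suc r} (s≤s 2≤r) = begin
  2 * suc r ≡⟨ *-suc 2 r ⟩
  2 + 2 * r ≤⟨ +-monoˡ-≤ (2 * r) 2≤r ⟩
  r + 2 * r ≡⟨ solve 1 (λ r → r :+ con 2 :* r := con 3 :* r) refl r ⟩
  3 * r     ∎
  where open ≤-Reasoning

-- With s/N ≥ 2 and q/(q-1) ≤ 3/2: 2 ≤ s/N < (q/(q-1)) (Q/P) forces Q/P > 4/3.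
abundant⇒4*P<3*Q : ∀ {N s q P Q} → 3 ≤ q → 2 * N ≤ s → s * ((q ∸ 1) * P) < N * (q * Q) → 4 * P < 3 * Q
abundant⇒4*P<3*Q {N} {s} {q} {P} {Q} 3≤q 2N≤s s*R<N*qQ = *-cancelʳ-< q (4 * P) (3 * Q) (begin-strict
  (4 * P) * q             ≡⟨ solve 2 (λ P q → (con 4 :* P) :* q := (con 2 :* P) :* (con 2 :* q)) refl P q ⟩
  (2 * P) * (2 * q)       ≤⟨ *-monoʳ-≤ (2 * P) (3≤q⇒2*q≤3*[q∸1] 3≤q) ⟩
  (2 * P) * (3 * (q ∸ 1)) ≡⟨ solve 2 (λ P d → (con 2 :* P) :* (con 3 :* d) := con 3 :* (con 2 :* (d :* P))) refl P (q ∸ 1) ⟩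
  3 * (2 * R)             <⟨ *-monoʳ-< 3 2R<qQ ⟩
  3 * (q * Q)             ≡⟨ solve 2 (λ q Q → con 3 :* (q :* Q) := (con 3 :* Q) :* q) refl q Q ⟩
  (3 * Q) * q             ∎)
  where
  open ≤-Reasoning
  R = (q ∸ 1) * P
  2R<qQ : 2 * R < q * Q
  2R<qQ = *-cancelˡ-< N (2 * R) (q * Q) (begin-strict
    N * (2 * R) ≡⟨ solve 2 (λ N R → N :* (con 2 :* R) := (con 2 :* N) :* R) refl N R ⟩
    (2 * N) * R ≤⟨ *-monoˡ-≤ R 2N≤s ⟩
    s * R       <⟨ s*R<N*qQ ⟩
    N * (q * Q) ∎)

cross-<-≤-trans : ∀ a c P Q P′ Q′ → a * P < c * Q → P′ * Q ≤ P * Q′ → 1 ≤ Q′ → a * P′ < c * Q′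
cross-<-≤-trans a c P Q P′ Q′ aP<cQ P′Q≤PQ′ 1≤Q′ = *-cancelʳ-< Q (a * P′) (c * Q′) (begin-strict
  (a * P′) * Q ≡⟨ *-assoc a P′ Q ⟩
  a * (P′ * Q) ≤⟨ *-monoʳ-≤ a P′Q≤PQ′ ⟩
  a * (P * Q′) ≡⟨ *-assoc a P Q′ ⟨
  (a * P) * Q′ <⟨ *-monoˡ-< Q′ {{>-nonZero 1≤Q′}} aP<cQ ⟩
  (c * Q) * Q′ ≡⟨ solve 3 (λ c Q Q′ → (c :* Q) :* Q′ := (c :* Q′) :* Q) refl c Q Q′ ⟩
  (c * Q′) * Q ∎)
  where open ≤-Reasoning

exceeds-from-primes≥ : ∀ {a c p} T → Prime p → AllPairs _<_ T → All Prime T → All (p ≤_) T →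
  a * product (map (_∸ 1) T) < c * product T → Exceeds a c p (length T)
exceeds-from-primes≥ {a} {c} {p} T pp sorted primes p≤T aP<cQ
  with consecutivePrimes-ratio-≥ T (suc (primesBelow p)) sorted primes (s≤s z≤n)
         (All.map (λ p≤t → s≤s (primesBelow-mono-≤ p≤t)) p≤T)
... | ps , consecutive , ratio , ∏ps≥1 =
  suc (primesBelow p) , (pp , refl) , ps , consecutive ,
  cross-<-≤-trans a c (product (map (_∸ 1) T)) (product T) (vprodPred ps) (vprod ps) aP<cQ ratio ∏ps≥1

IsB⇒≤ : ∀ {a c p b b′} → c ≤ a → IsB a c p b → Exceeds a c p b′ → b ≤ b′
IsB⇒≤ {a} {c} {b′ = zero} c≤a _ (_ , _ , [] , _ , a*1<c*1) =
  ⊥-elim (<⇒≱ (subst₂ _<_ (*-identityʳ a) (*-identityʳ c) a*1<c*1) c≤a)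
IsB⇒≤ {b = b} {b′ = suc b′} _ (_ , _ , minimal) exceeds with b ≤? suc b′
... | yes b≤b′ = b≤b′
... | no b≰b′ = ⊥-elim (minimal (suc b′) (s≤s z≤n) (≰⇒> b≰b′) exceeds)

primeDivisor? : ∀ N p → Dec (Prime p × p ∣ N)
primeDivisor? N p = prime? p ×-dec p ∣? N

primeDivisors : ℕ → List ℕ
primeDivisors N = filter (primeDivisor? N) (upTo (suc N))

primeDivisors-sorted : ∀ N → AllPairs _<_ (primeDivisors N)
primeDivisors-sorted N = AllPairs.filter⁺ (primeDivisor? N) (AllPairs.applyUpTo⁺₁ id (suc N) (λ i<j _ → i<j))

primeDivisors-sound : ∀ N → All (λ p → Prime p × p ∣ N) (primeDivisors N)
primeDivisors-sound N = All.all-filter (primeDivisor? N) (upTo (suc N))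

primeDivisors-complete : ∀ N → .{{NonZero N}} → ∀ p → Prime p → p ∣ N → p ∈ primeDivisors N
primeDivisors-complete N p pp p∣N = ∈-filter⁺ (primeDivisor? N) (∈-upTo⁺ (s≤s (∣⇒≤ p∣N))) (pp , p∣N)

odd-prime-divisor≥3 : ∀ {N q} → ¬ 2 ∣ N → Prime q → q ∣ N → 3 ≤ q
odd-prime-divisor≥3 {q = 2} 2∤N _ 2∣N = ⊥-elim (2∤N 2∣N)
odd-prime-divisor≥3 {q = suc (suc (suc _))} _ _ _ = s≤s (s≤s (s≤s z≤n))

-- A prime divisor below p₂ must be p₁, which is q₁, and the tail lies strictly above q₁.
secondSmallest⇒tail≥ : ∀ {N p₂ q₁ T} → IsSecondSmallestPrimeDivisor N p₂ →
  AllPairs _<_ (q₁ ∷ T) → All (λ p → Prime p × p ∣ N) (q₁ ∷ T) → All (p₂ ≤_) T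
secondSmallest⇒tail≥ {N} {p₂} {q₁} (_ , _ , _ , _ , _ , _ , only-p₁) (q₁<T ∷ _) ((pq₁ , q₁∣N) ∷ primeDivisorsT) =
  All.zipWith above (q₁<T , primeDivisorsT)
  where
  above : ∀ {t} → q₁ < t × (Prime t × t ∣ N) → p₂ ≤ t
  above {t} (q₁<t , pt , t∣N) with p₂ ≤? t
  ... | yes p₂≤t = p₂≤t
  ... | no p₂≰t = ⊥-elim (<-irrefl (trans q₁≡p₁ (sym t≡p₁)) q₁<t)
    where
    t<p₂ = ≰⇒> p₂≰t
    t≡p₁ = only-p₁ t pt t∣N t<p₂
    q₁≡p₁ = only-p₁ q₁ pq₁ q₁∣N (<-trans q₁<t t<p₂)

proposition1 : (N p₂ k b : ℕ) → ¬ (2 ∣ N) → 2 * N ≤ σ N →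
    IsSecondSmallestPrimeDivisor N p₂ → k ≡ ω N →
    IsB 4 3 p₂ b → b + 1 ≤ k
proposition1 zero _ _ _ 2∤N _ _ _ _ = ⊥-elim (2∤N (2 ∣0))
proposition1 N@(suc _) p₂ _ b 2∤N 2N≤σN second@(pp₂ , p₂∣N , _) refl isB
  with primeDivisors N | primeDivisors-sorted N | primeDivisors-sound N | primeDivisors-complete N
... | [] | _ | _ | complete with complete p₂ pp₂ p₂∣N
...   | ()
proposition1 N@(suc _) p₂ _ b 2∤N 2N≤σN second@(pp₂ , p₂∣N , _) refl isB
    | q₁ ∷ T | sorted@(_ ∷ sortedT) | sound@((pq₁ , q₁∣N) ∷ soundT) | complete =
  subst (_≤ suc (length T)) (+-comm 1 b) (s≤s (IsB⇒≤ (n≤1+n 3) isB exceeds))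
  where
  4∏[t∸1]<3∏t : 4 * product (map (_∸ 1) T) < 3 * product T
  4∏[t∸1]<3∏t = abundant⇒4*P<3*Q (odd-prime-divisor≥3 2∤N pq₁ q₁∣N) 2N≤σN
    (abundancy-< q₁ T N (All.map proj₁ sound) complete)
  exceeds : Exceeds 4 3 p₂ (length T)
  exceeds = exceeds-from-primes≥ {4} {3} T pp₂ sortedT (All.map proj₁ soundT)
    (secondSmallest⇒tail≥ second sorted sound) 4∏[t∸1]<3∏t
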